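{- Let $Z=(U,\Omega,\mathcal{C})$ be a tight multimatroid in which every skew class has at least two elements, and let $T\in\mathcal{T}(\Omega)$. Then $T\in\mathrm{Ort}(Z)$ if and only if $|C\cap T|\neq 1$ for every circuit $C$ of $Z$.
   Context: A carrier is a pair $(U,\Omega)$, $U$ finite, $\Omega$ a partition of $U$ into skew classes; a skew pair is a 2-element subset of a skew class. Transversals ($|T\cap\omega|=1$ for all $\omega$) and subtransversals form $\mathcal{T}(\Omega)$, $\mathcal{S}(\Omega)$. A semi-multimatroid $Z=(U,\Omega,\mathcal{C})$ has circuits $\mathcal{C}\subseteq\mathcal{S}(\Omega)$ such that for each transversal $T$, $(T,\mathcal{C}\cap 2^T)$ is a matroid (by circuits); $Z[S]=(S,\mathcal C\cap 2^S)$ for $S\in\mathcal S(\Omega)$. For $X\subseteq U$, $Z-X$ has ground set $U\setminus X$, skew classes the nonempty sets $\omega\setminus X$, and circuits those of $Z$ disjoint from $X$. A multimatroid is a semi-multimatroid where no union of two circuits contains exactly one skew pair; it is tight if for every $S\in\mathcal{S}(\Omega)$ with $|S|=|\Omega|-1$ and $\omega$ the skew class disjoint from $S$, some $x\in\omega$ makes the circuit families of $Z[S\cup\{x\}]$ and $Z[S]$ differ. $\mathrm{Ort}(Z)=\{T\in\mathcal{T}(\Omega):Z-T\text{ is tight}\}$. -}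

module Defs where

open import Data.Nat using (ℕ; suc)
open import Data.Fin using (Fin; _≟_)
open import Data.Fin.Properties using (any?)
open import Data.Fin.Subset using (Subset; _∈_; _∉_; _⊆_; _∪_; _∩_; ∁; ∣_∣; ⊥; ⁅_⁆; inside; outside)
open import Data.Fin.Subset.Properties using (_∈?_)
open import Data.Vec using (tabulate)
open import Data.Bool using (if_then_else_)
open import Data.Product using (Σ; ∃; _×_; _,_)
open import Data.Sum using (_⊎_)
open import Relation.Nullary using (¬_)
open import Relation.Nullary.Decidable using (⌊_⌋; _×-dec_)
open import Relation.Binary.PropositionalEquality using (_≡_; _≢_)

-- A carrier is represented by a ground set G ⊆ Fin n together with a
-- labelling cls : Fin n → Fin m; the skew classes are the NONEMPTY sets
-- {x ∈ G | cls x ≡ i}.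

Fam : ℕ → Set₁
Fam n = Subset n → Set

module _ {n m : ℕ} (G : Subset n) (cls : Fin n → Fin m) where

  InClass : Fin m → Fin n → Set
  InClass i x = x ∈ G × cls x ≡ i

  IsClass : Fin m → Set
  IsClass i = ∃ λ x → InClass i x

  classLabels : Subset m
  classLabels = tabulate λ i →
    if ⌊ any? (λ x → (x ∈? G) ×-dec (cls x ≟ i)) ⌋ then inside else outside

  numClasses : ℕ
  numClasses = ∣ classLabels ∣

  Subtransversal : Subset n → Set
  Subtransversal S = S ⊆ G × (∀ x y → x ∈ S → y ∈ S → cls x ≡ cls y → x ≡ y)

  Transversal : Subset n → Set
  Transversal T = Subtransversal T × (∀ i → IsClass i → ∃ λ x → x ∈ T × cls x ≡ i)

  SkewPairIn : Subset n → Fin n → Fin n → Set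
  SkewPairIn A x y = x ≢ y × x ∈ A × y ∈ A × x ∈ G × y ∈ G × cls x ≡ cls y

  ExactlyOneSkewPair : Subset n → Set
  ExactlyOneSkewPair A = ∃ λ x → ∃ λ y → SkewPairIn A x y ×
    (∀ x' y' → SkewPairIn A x' y' → (x' ≡ x × y' ≡ y) ⊎ (x' ≡ y × y' ≡ x))

  Restr : Fam n → Subset n → Fam n
  Restr circ S C = circ C × C ⊆ S

  Differ : Fam n → Fam n → Set
  Differ F H = ∃ λ C → (F C × ¬ H C) ⊎ (H C × ¬ F C)

  MatroidCircuits : Fam n → Set
  MatroidCircuits F =
    ¬ F ⊥ ×
    (∀ C₁ C₂ → F C₁ → F C₂ → C₁ ⊆ C₂ → C₁ ≡ C₂) ×
    (∀ C₁ C₂ e → F C₁ → F C₂ → C₁ ≢ C₂ → e ∈ C₁ → e ∈ C₂ →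
       ∃ λ C₃ → F C₃ × C₃ ⊆ (C₁ ∪ C₂) × e ∉ C₃)

  IsSemiMultimatroid : Fam n → Set
  IsSemiMultimatroid circ =
    (∀ C → circ C → Subtransversal C) ×
    (∀ T → Transversal T → MatroidCircuits (Restr circ T))

  IsMultimatroid : Fam n → Set
  IsMultimatroid circ = IsSemiMultimatroid circ ×
    (∀ C₁ C₂ → circ C₁ → circ C₂ → ¬ ExactlyOneSkewPair (C₁ ∪ C₂))

  IsTight : Fam n → Set
  IsTight circ = ∀ S → Subtransversal S → suc ∣ S ∣ ≡ numClasses →
    ∀ i → IsClass i → (∀ x → x ∈ S → cls x ≢ i) →
    ∃ λ x → InClass i x × Differ (Restr circ (S ∪ ⁅ x ⁆)) (Restr circ S)

minusGround : ∀ {n} → Subset n → Subset n → Subset n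
minusGround G X = G ∩ ∁ X

minusCirc : ∀ {n} → Fam n → Subset n → Fam n
minusCirc circ X C = circ C × (∀ x → x ∈ C → x ∉ X)

Ort : ∀ {n m} → Subset n → (Fin n → Fin m) → Fam n → Subset n → Set
Ort G cls circ T = Transversal G cls T × IsTight (minusGround G T) cls (minusCirc circ T)

-- If a circuit C meets T only in t, extend C − T by elements outside T to a transversal S
-- of all skew classes of Z − T except the class of t. Tightness of Z − T gives an x in that
-- class and a circuit C′ ⊆ S ∪ {x} of Z − T through x; then {t, x} is the only skew pair in
-- C ∪ C′, which the multimatroid axiom forbids. Conversely, since every skew class has an
-- element outside T, Z − T has the same skew classes as Z, so tightness of Z gives, for a
-- subtransversal S of Z − T, a circuit C ⊆ S ∪ {x} through x; were x ∈ T, C would meet T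
-- exactly in x, so x ∉ T and C is a circuit of Z − T.
module Submission where

open import Defs
open import Data.Nat using (ℕ; zero; suc)
open import Data.Nat.Properties using (suc-injective)
open import Data.Fin using (Fin; zero; suc; _≟_)
open import Data.Fin.Properties using (any?) renaming (suc-injective to Fin-suc-injective)
open import Data.Fin.Subset
  using (Subset; _∈_; _∉_; _⊆_; _∪_; _∩_; ∁; ∣_∣; ⊥; ⊤; ⁅_⁆; inside; outside)
open import Data.Fin.Subset.Properties
open import Data.Vec using (_∷_; []; tabulate; here; there)
open import Data.Vec.Properties using (lookup∘tabulate; []=⇒lookup; lookup⇒[]=)
open import Data.Bool using (if_then_else_)
open import Data.Product using (∃; _×_; _,_; proj₁; proj₂)
open import Data.Sum using (_⊎_; inj₁; inj₂; map₂)
open import Data.Empty using (⊥-elim)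
open import Function using (_∘_)
open import Function.Bundles using (_⇔_; mk⇔)
open import Relation.Nullary using (¬_; Dec; yes; no; ¬?; contradiction)
open import Relation.Nullary.Decidable using (⌊_⌋; _×-dec_; _⊎-dec_)
open import Level using (0ℓ)
open import Relation.Unary using (Pred; Decidable)
open import Relation.Binary.PropositionalEquality
  using (_≡_; _≢_; refl; sym; trans; cong; subst)

fromDec : ∀ {n} {P : Pred (Fin n) 0ℓ} → Decidable P → Subset n
fromDec P? = tabulate λ x → if ⌊ P? x ⌋ then inside else outside

module _ {n} {P : Pred (Fin n) 0ℓ} (P? : Decidable P) {x : Fin n} where

  ∈-fromDec⁻ : x ∈ fromDec P? → P x
  ∈-fromDec⁻ x∈ = side⁻ (P? x) (trans (sym (lookup∘tabulate _ x)) ([]=⇒lookup x∈))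
    where
    side⁻ : (d : Dec (P x)) → (if ⌊ d ⌋ then inside else outside) ≡ inside → P x
    side⁻ (yes px) _ = px

  ∈-fromDec⁺ : P x → x ∈ fromDec P?
  ∈-fromDec⁺ px = lookup⇒[]= x _ (trans (lookup∘tabulate _ x) (side⁺ (P? x)))
    where
    side⁺ : (d : Dec (P x)) → (if ⌊ d ⌋ then inside else outside) ≡ inside
    side⁺ (yes _)  = refl
    side⁺ (no ¬px) = contradiction px ¬px

∣p∣≡0⇒p≡⊥ : ∀ {n} (p : Subset n) → ∣ p ∣ ≡ 0 → p ≡ ⊥
∣p∣≡0⇒p≡⊥ []            _  = refl
∣p∣≡0⇒p≡⊥ (outside ∷ p) eq = cong (outside ∷_) (∣p∣≡0⇒p≡⊥ p eq)
∣p∣≡0⇒p≡⊥ (inside  ∷ p) ()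

∣p∣≡1⇒p≡⁅x⁆ : ∀ {n} (p : Subset n) → ∣ p ∣ ≡ 1 → ∃ λ x → p ≡ ⁅ x ⁆
∣p∣≡1⇒p≡⁅x⁆ (outside ∷ p) eq with ∣p∣≡1⇒p≡⁅x⁆ p eq
... | x , p≡⁅x⁆ = suc x , cong (outside ∷_) p≡⁅x⁆
∣p∣≡1⇒p≡⁅x⁆ (inside ∷ p) eq = zero , cong (inside ∷_) (∣p∣≡0⇒p≡⊥ p (suc-injective eq))

x∉p⇒∣p∪⁅x⁆∣≡1+∣p∣ : ∀ {n} (p : Subset n) {x} → x ∉ p → ∣ p ∪ ⁅ x ⁆ ∣ ≡ suc ∣ p ∣
x∉p⇒∣p∪⁅x⁆∣≡1+∣p∣ (outside ∷ p) {zero}  _   = cong (suc ∘ ∣_∣) (∪-identityʳ p)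
x∉p⇒∣p∪⁅x⁆∣≡1+∣p∣ (inside  ∷ p) {zero}  x∉p = contradiction here x∉p
x∉p⇒∣p∪⁅x⁆∣≡1+∣p∣ (outside ∷ p) {suc x} x∉p = x∉p⇒∣p∪⁅x⁆∣≡1+∣p∣ p (x∉p ∘ there)
x∉p⇒∣p∪⁅x⁆∣≡1+∣p∣ (inside  ∷ p) {suc x} x∉p =
  cong suc (x∉p⇒∣p∪⁅x⁆∣≡1+∣p∣ p (x∉p ∘ there))

∈-∪⁅⁆⁻ : ∀ {n} (p : Subset n) {x y} → y ∈ p ∪ ⁅ x ⁆ → y ∈ p ⊎ y ≡ x
∈-∪⁅⁆⁻ p y∈ with x∈p∪q⁻ p _ y∈
... | inj₁ y∈p  = inj₁ y∈p
... | inj₂ y∈⁅x⁆ = inj₂ (x∈⁅y⁆⇒x≡y _ y∈⁅x⁆)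

p⊆q∪⁅x⁆⇒p∩r≡⁅x⁆ : ∀ {n} {p q r : Subset n} {x} → p ⊆ q ∪ ⁅ x ⁆ → (∀ y → y ∈ q → y ∉ r) →
                   x ∈ p → x ∈ r → p ∩ r ≡ ⁅ x ⁆
p⊆q∪⁅x⁆⇒p∩r≡⁅x⁆ {p = p} {q} {r} {x} p⊆q∪x q∩r≡∅ x∈p x∈r = ⊆-antisym to from
  where
  to : p ∩ r ⊆ ⁅ x ⁆
  to y∈p∩r with x∈p∩q⁻ p r y∈p∩r
  ... | y∈p , y∈r with ∈-∪⁅⁆⁻ q (p⊆q∪x y∈p)
  ... | inj₁ y∈q = contradiction y∈r (q∩r≡∅ _ y∈q)
  ... | inj₂ refl = x∈⁅x⁆ x
  from : ⁅ x ⁆ ⊆ p ∩ r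
  from y∈⁅x⁆ with x∈⁅y⁆⇒x≡y x y∈⁅x⁆
  ... | refl = x∈p∩q⁺ (x∈p , x∈r)

⊆-antisym′ : ∀ {n} {p q : Subset n} → (∀ x → x ∈ p → x ∈ q) → (∀ x → x ∈ q → x ∈ p) → p ≡ q
⊆-antisym′ p⊆q q⊆p = ⊆-antisym (p⊆q _) (q⊆p _)

module _ {n m} {G : Subset n} {cls : Fin n → Fin m} {i : Fin m} where

  ∈-classLabels⁺ : IsClass G cls i → i ∈ classLabels G cls
  ∈-classLabels⁺ = ∈-fromDec⁺ λ j → any? λ x → (x ∈? G) ×-dec (cls x ≟ j)

  ∈-classLabels⁻ : i ∈ classLabels G cls → IsClass G cls i
  ∈-classLabels⁻ = ∈-fromDec⁻ λ j → any? λ x → (x ∈? G) ×-dec (cls x ≟ j)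

module _ {n n′ m} (G : Subset n) (cls : Fin n → Fin m) (G′ : Subset n′) (cls′ : Fin n′ → Fin m) where

  classLabels-cong : (∀ j → IsClass G cls j → IsClass G′ cls′ j) →
                     (∀ j → IsClass G′ cls′ j → IsClass G cls j) →
                     classLabels G cls ≡ classLabels G′ cls′
  classLabels-cong to from = ⊆-antisym′
    (λ j → ∈-classLabels⁺ ∘ to j ∘ ∈-classLabels⁻)
    (λ j → ∈-classLabels⁺ ∘ from j ∘ ∈-classLabels⁻)

  numClasses-suc : ∀ {i} → IsClass G cls i → ¬ IsClass G′ cls′ i →
                   (∀ j → IsClass G cls j → IsClass G′ cls′ j ⊎ j ≡ i) →
                   (∀ j → IsClass G′ cls′ j → IsClass G cls j) →
                   numClasses G cls ≡ suc (numClasses G′ cls′)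
  numClasses-suc {i} i-class i-new to from =
    trans (cong ∣_∣ (⊆-antisym′ to′ from′))
          (x∉p⇒∣p∪⁅x⁆∣≡1+∣p∣ (classLabels G′ cls′) (i-new ∘ ∈-classLabels⁻))
    where
    to′ : ∀ j → j ∈ classLabels G cls → j ∈ classLabels G′ cls′ ∪ ⁅ i ⁆
    to′ j j∈ with to j (∈-classLabels⁻ j∈)
    ... | inj₁ j-class = x∈p∪q⁺ (inj₁ (∈-classLabels⁺ j-class))
    ... | inj₂ refl    = x∈p∪q⁺ (inj₂ (x∈⁅x⁆ j))
    from′ : ∀ j → j ∈ classLabels G′ cls′ ∪ ⁅ i ⁆ → j ∈ classLabels G cls
    from′ j j∈ with ∈-∪⁅⁆⁻ (classLabels G′ cls′) j∈
    ... | inj₁ j∈′ = ∈-classLabels⁺ (from j (∈-classLabels⁻ j∈′))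
    ... | inj₂ refl = ∈-classLabels⁺ i-class

injective-tail : ∀ {n m s} {S : Subset n} {cls : Fin (suc n) → Fin m} →
  (∀ x y → x ∈ s ∷ S → y ∈ s ∷ S → cls x ≡ cls y → x ≡ y) →
  (∀ x y → x ∈ S → y ∈ S → cls (suc x) ≡ cls (suc y) → x ≡ y)
injective-tail inj x y x∈ y∈ e = Fin-suc-injective (inj (suc x) (suc y) (there x∈) (there y∈) e)

injective⇒∣S∣≡numClasses : ∀ {n m} (S : Subset n) (cls : Fin n → Fin m) →
  (∀ x y → x ∈ S → y ∈ S → cls x ≡ cls y → x ≡ y) → ∣ S ∣ ≡ numClasses S cls
injective⇒∣S∣≡numClasses {m = m} [] cls _ =
  sym (trans (cong ∣_∣ (Empty-unique λ { (_ , i∈) → noClass (∈-classLabels⁻ i∈) })) (∣⊥∣≡0 m))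
  where
  noClass : ∀ {i} → ¬ IsClass [] cls i
  noClass (() , _)
injective⇒∣S∣≡numClasses (outside ∷ S) cls inj =
  trans (injective⇒∣S∣≡numClasses S (cls ∘ suc) (injective-tail inj))
        (cong ∣_∣ (classLabels-cong S (cls ∘ suc) (outside ∷ S) cls
          (λ { _ (x , x∈ , e) → suc x , there x∈ , e })
          (λ { _ (zero , () , _) ; _ (suc x , x∈ , e) → x , drop-there x∈ , e })))
injective⇒∣S∣≡numClasses (inside ∷ S) cls inj =
  trans (cong suc (injective⇒∣S∣≡numClasses S (cls ∘ suc) (injective-tail inj)))
        (sym (numClasses-suc (inside ∷ S) cls S (cls ∘ suc) (zero , here , refl) head-new to from))
  where
  head-new : ¬ IsClass S (cls ∘ suc) (cls zero)
  head-new (x , x∈ , e) with inj zero (suc x) here (there x∈) (sym e)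
  ... | ()
  to : ∀ j → IsClass (inside ∷ S) cls j → IsClass S (cls ∘ suc) j ⊎ j ≡ cls zero
  to _ (zero  , _  , e) = inj₂ (sym e)
  to _ (suc x , x∈ , e) = inj₁ (x , drop-there x∈ , e)
  from : ∀ j → IsClass S (cls ∘ suc) j → IsClass (inside ∷ S) cls j
  from _ (x , x∈ , e) = suc x , there x∈ , e

record TransversalOmitting {n m} (G : Subset n) (cls : Fin n → Fin m) (i : Fin m) (S : Subset n) : Set where
  field
    subtransversal : Subtransversal G cls S
    avoids         : ∀ x → x ∈ S → cls x ≢ i
    covers         : ∀ j → IsClass G cls j → j ≢ i → ∃ λ x → x ∈ S × cls x ≡ j

  suc∣S∣≡numClasses : IsClass G cls i → suc ∣ S ∣ ≡ numClasses G cls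
  suc∣S∣≡numClasses i-class =
    trans (cong suc (injective⇒∣S∣≡numClasses S cls (proj₂ subtransversal)))
          (sym (numClasses-suc G cls S cls i-class i-new to from))
    where
    i-new : ¬ IsClass S cls i
    i-new (x , x∈S , e) = avoids x x∈S e
    to : ∀ j → IsClass G cls j → IsClass S cls j ⊎ j ≡ i
    to j j-class with j ≟ i
    ... | yes j≡i = inj₂ j≡i
    ... | no  j≢i = inj₁ (covers j j-class j≢i)
    from : ∀ j → IsClass S cls j → IsClass G cls j
    from _ (x , x∈S , e) = x , proj₁ subtransversal x∈S , e

module _ {n m} {G : Subset n} {cls : Fin n → Fin m} (ρ : Fin n → Fin n)
  (ρ-∈ : ∀ x → ρ x ∈ G) (ρ-cls : ∀ x → cls (ρ x) ≡ cls x)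
  (ρ-cong : ∀ x y → cls x ≡ cls y → ρ x ≡ ρ y) where

  extend-subtransversal : ∀ {A i} → Subtransversal G cls A → (∀ x → x ∈ A → cls x ≢ i) →
                          ∃ λ S → A ⊆ S × TransversalOmitting G cls i S
  extend-subtransversal {A} {i} (A⊆G , A-inj) A-avoids = S , ∈-fromDec⁺ chosen? ∘ inj₁ , record
    { subtransversal = S⊆G , S-inj
    ; avoids         = avoids
    ; covers         = covers
    }
    where
    MeetsA : Fin m → Set
    MeetsA j = ∃ λ y → y ∈ A × cls y ≡ j

    meetsA? : ∀ j → Dec (MeetsA j)
    meetsA? j = any? λ y → (y ∈? A) ×-dec (cls y ≟ j)

    Chosen : Fin n → Set
    Chosen x = x ∈ A ⊎ (cls x ≢ i × ¬ MeetsA (cls x) × x ≡ ρ x)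

    chosen? : ∀ x → Dec (Chosen x)
    chosen? x = (x ∈? A) ⊎-dec (¬? (cls x ≟ i) ×-dec ¬? (meetsA? (cls x)) ×-dec (x ≟ ρ x))

    S : Subset n
    S = fromDec chosen?

    S⊆G : S ⊆ G
    S⊆G x∈S with ∈-fromDec⁻ chosen? x∈S
    ... | inj₁ x∈A            = A⊆G x∈A
    ... | inj₂ (_ , _ , x≡ρx) = subst (_∈ G) (sym x≡ρx) (ρ-∈ _)

    S-inj : ∀ x y → x ∈ S → y ∈ S → cls x ≡ cls y → x ≡ y
    S-inj x y x∈S y∈S e with ∈-fromDec⁻ chosen? x∈S | ∈-fromDec⁻ chosen? y∈S
    ... | inj₁ x∈A | inj₁ y∈A = A-inj x y x∈A y∈A e
    ... | inj₁ x∈A | inj₂ (_ , ¬meets , _) = contradiction (x , x∈A , e) ¬meets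
    ... | inj₂ (_ , ¬meets , _) | inj₁ y∈A = contradiction (y , y∈A , sym e) ¬meets
    ... | inj₂ (_ , _ , x≡ρx) | inj₂ (_ , _ , y≡ρy) = trans x≡ρx (trans (ρ-cong x y e) (sym y≡ρy))

    avoids : ∀ x → x ∈ S → cls x ≢ i
    avoids x x∈S with ∈-fromDec⁻ chosen? x∈S
    ... | inj₁ x∈A           = A-avoids x x∈A
    ... | inj₂ (x≢i , _ , _) = x≢i

    covers : ∀ j → IsClass G cls j → j ≢ i → ∃ λ x → x ∈ S × cls x ≡ j
    covers j (y , _ , refl) j≢i with meetsA? j
    ... | yes (x , x∈A , e) = x , ∈-fromDec⁺ chosen? (inj₁ x∈A) , e
    ... | no ¬meets =
      ρ y , ∈-fromDec⁺ chosen? (inj₂ (ρy≢i , ρy-new , sym (ρ-cong _ _ (ρ-cls y)))) , ρ-cls y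
      where
      ρy≢i : cls (ρ y) ≢ i
      ρy≢i = j≢i ∘ trans (sym (ρ-cls y))
      ρy-new : ¬ MeetsA (cls (ρ y))
      ρy-new (x , x∈A , e) = ¬meets (x , x∈A , trans e (ρ-cls y))

NewCircuit : ∀ {n} → Fam n → Subset n → Fin n → Set
NewCircuit circ S x = ∃ λ C → circ C × C ⊆ S ∪ ⁅ x ⁆ × x ∈ C

module _ {n m} {G : Subset n} {cls : Fin n → Fin m} {circ : Fam n} {S : Subset n} {x : Fin n} where

  Differ⇒NewCircuit : Differ G cls (Restr G cls circ (S ∪ ⁅ x ⁆)) (Restr G cls circ S) →
                      NewCircuit circ S x
  Differ⇒NewCircuit (C , inj₂ ((circ-C , C⊆S) , ¬new)) =
    ⊥-elim (¬new (circ-C , p⊆p∪q ⁅ x ⁆ ∘ C⊆S))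
  Differ⇒NewCircuit (C , inj₁ ((circ-C , C⊆S∪x) , ¬old)) with x ∈? C
  ... | yes x∈C = C , circ-C , C⊆S∪x , x∈C
  ... | no  x∉C = ⊥-elim (¬old (circ-C , C⊆S))
    where
    C⊆S : C ⊆ S
    C⊆S y∈C with ∈-∪⁅⁆⁻ S (C⊆S∪x y∈C)
    ... | inj₁ y∈S = y∈S
    ... | inj₂ refl = contradiction y∈C x∉C

  NewCircuit⇒Differ : x ∉ S → NewCircuit circ S x →
                      Differ G cls (Restr G cls circ (S ∪ ⁅ x ⁆)) (Restr G cls circ S)
  NewCircuit⇒Differ x∉S (C , circ-C , C⊆S∪x , x∈C) =
    C , inj₁ ((circ-C , C⊆S∪x) , λ { (_ , C⊆S) → x∉S (C⊆S x∈C) })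

module _ {n m} {G : Subset n} {cls : Fin n → Fin m} {S A : Subset n} {t x : Fin n} where

  onlySkewPair : (∀ y z → y ∈ S → z ∈ S → cls y ≡ cls z → y ≡ z) → (∀ z → z ∈ S → cls z ≢ cls t) →
                 t ≢ x → cls t ≡ cls x → t ∈ G → x ∈ G → t ∈ A → x ∈ A →
                 (∀ z → z ∈ A → z ∈ S ⊎ z ≡ t ⊎ z ≡ x) →
                 ExactlyOneSkewPair G cls A
  onlySkewPair S-inj avoids t≢x t~x t∈G x∈G t∈A x∈A A⊆ =
    t , x , (t≢x , t∈A , x∈A , t∈G , x∈G , t~x) , unique
    where
    cls-pair : ∀ {z} → z ≡ t ⊎ z ≡ x → cls z ≡ cls t
    cls-pair (inj₁ refl) = refl
    cls-pair (inj₂ refl) = sym t~x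
    unique : ∀ y z → SkewPairIn G cls A y z → (y ≡ t × z ≡ x) ⊎ (y ≡ x × z ≡ t)
    unique y z (y≢z , y∈A , z∈A , _ , _ , y~z) with A⊆ y y∈A | A⊆ z z∈A
    ... | inj₁ y∈S | inj₁ z∈S = contradiction (S-inj y z y∈S z∈S y~z) y≢z
    ... | inj₁ y∈S | inj₂ z-pair = contradiction (trans y~z (cls-pair z-pair)) (avoids y y∈S)
    ... | inj₂ y-pair | inj₁ z∈S = contradiction (trans (sym y~z) (cls-pair y-pair)) (avoids z z∈S)
    ... | inj₂ (inj₁ refl) | inj₂ (inj₁ refl) = contradiction refl y≢z
    ... | inj₂ (inj₂ refl) | inj₂ (inj₂ refl) = contradiction refl y≢z
    ... | inj₂ (inj₁ refl) | inj₂ (inj₂ refl) = inj₁ (refl , refl)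
    ... | inj₂ (inj₂ refl) | inj₂ (inj₁ refl) = inj₂ (refl , refl)

tight⇒NewCircuit : ∀ {n m} {G : Subset n} {cls : Fin n → Fin m} {circ : Fam n} {i S} →
  IsTight G cls circ → IsClass G cls i → TransversalOmitting G cls i S →
  ∃ λ x → InClass G cls i x × NewCircuit circ S x
tight⇒NewCircuit {G = G} {cls} {S = S} tight i-class S-omits =
  let x , x∈i , differ = tight S subtransversal (suc∣S∣≡numClasses i-class) _ i-class avoids
  in  x , x∈i , Differ⇒NewCircuit {G = G} {cls} differ
  where open TransversalOmitting S-omits

module _ {n} {G X : Subset n} {x : Fin n} where

  ∈-minusGround⁺ : x ∈ G → x ∉ X → x ∈ minusGround G X
  ∈-minusGround⁺ x∈G x∉X = x∈p∩q⁺ (x∈G , x∉p⇒x∈∁p x∉X)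

  ∈-minusGround⁻ : x ∈ minusGround G X → x ∈ G × x ∉ X
  ∈-minusGround⁻ x∈ with x∈p∩q⁻ G (∁ X) x∈
  ... | x∈G , x∈∁X = x∈G , x∈∁p⇒x∉p x∈∁X

module _ {n m} {cls : Fin n → Fin m} {T : Subset n} (T-transversal : Transversal ⊤ cls T)
  (twoElements : ∀ x → ∃ λ y → y ≢ x × cls y ≡ cls x) where

  private
    T-inj : ∀ x y → x ∈ T → y ∈ T → cls x ≡ cls y → x ≡ y
    T-inj = proj₂ (proj₁ T-transversal)

    inT : Fin n → Fin n
    inT x = proj₁ (proj₂ T-transversal (cls x) (x , ∈⊤ , refl))

    inT-∈ : ∀ x → inT x ∈ T
    inT-∈ x = proj₁ (proj₂ (proj₂ T-transversal (cls x) (x , ∈⊤ , refl)))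

    inT-cls : ∀ x → cls (inT x) ≡ cls x
    inT-cls x = proj₂ (proj₂ (proj₂ T-transversal (cls x) (x , ∈⊤ , refl)))

    inT-cong : ∀ x y → cls x ≡ cls y → inT x ≡ inT y
    inT-cong x y e = T-inj _ _ (inT-∈ x) (inT-∈ y) (trans (inT-cls x) (trans e (sym (inT-cls y))))

  offT : Fin n → Fin n
  offT x = proj₁ (twoElements (inT x))

  offT-cls : ∀ x → cls (offT x) ≡ cls x
  offT-cls x = trans (proj₂ (proj₂ (twoElements (inT x)))) (inT-cls x)

  offT-∈ : ∀ x → offT x ∈ minusGround ⊤ T
  offT-∈ x = ∈-minusGround⁺ ∈⊤ λ offT∈T →
    proj₁ (proj₂ (twoElements (inT x)))
          (T-inj _ _ offT∈T (inT-∈ x) (trans (offT-cls x) (sym (inT-cls x))))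

  offT-cong : ∀ x y → cls x ≡ cls y → offT x ≡ offT y
  offT-cong x y = cong (proj₁ ∘ twoElements) ∘ inT-cong x y

  classLabels-minusGround : classLabels ⊤ cls ≡ classLabels (minusGround ⊤ T) cls
  classLabels-minusGround = classLabels-cong ⊤ cls (minusGround ⊤ T) cls
    (λ { _ (x , _ , e) → offT x , offT-∈ x , trans (offT-cls x) e })
    (λ { _ (x , _ , e) → x , ∈⊤ , e })

  circuit∖T-omitting : ∀ {C t} → Subtransversal ⊤ cls C → t ∈ C → t ∈ T →
    ∃ λ S → minusGround C T ⊆ S × TransversalOmitting (minusGround ⊤ T) cls (cls t) S
  circuit∖T-omitting {C} {t} (_ , C-inj) t∈C t∈T =
    extend-subtransversal offT offT-∈ offT-cls offT-cong (C∖T⊆ , C∖T-inj) C∖T-avoids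
    where
    C∖T⊆ : minusGround C T ⊆ minusGround ⊤ T
    C∖T⊆ z∈ = ∈-minusGround⁺ ∈⊤ (proj₂ (∈-minusGround⁻ z∈))
    C∖T-inj : ∀ y z → y ∈ minusGround C T → z ∈ minusGround C T → cls y ≡ cls z → y ≡ z
    C∖T-inj y z y∈ z∈ = C-inj y z (proj₁ (∈-minusGround⁻ y∈)) (proj₁ (∈-minusGround⁻ z∈))
    C∖T-avoids : ∀ z → z ∈ minusGround C T → cls z ≢ cls t
    C∖T-avoids z z∈ e with C-inj z t (proj₁ (∈-minusGround⁻ z∈)) t∈C e
    ... | refl = proj₂ (∈-minusGround⁻ z∈) t∈T

  module _ {circ : Fam n} where

    Ort⇒noCircuitMeetsOnce : IsMultimatroid ⊤ cls circ → Ort ⊤ cls circ T →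
                             ∀ C → circ C → ∣ C ∩ T ∣ ≢ 1
    Ort⇒noCircuitMeetsOnce (semi , noOnlySkewPair) (_ , Z−T-tight) C circ-C |C∩T|≡1
      with ∣p∣≡1⇒p≡⁅x⁆ (C ∩ T) |C∩T|≡1
    ... | t , C∩T≡⁅t⁆ with x∈p∩q⁻ C T (subst (t ∈_) (sym C∩T≡⁅t⁆) (x∈⁅x⁆ t))
    ... | t∈C , t∈T with circuit∖T-omitting (proj₁ semi C circ-C) t∈C t∈T
    ... | S , C∖T⊆S , S-omits
      with tight⇒NewCircuit Z−T-tight (offT t , offT-∈ t , offT-cls t) S-omits
    ... | x , (x∈G′ , x-cls) , C′ , (circ-C′ , _) , C′⊆S∪x , x∈C′ =
      noOnlySkewPair C C′ circ-C circ-C′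
        (onlySkewPair (proj₂ subtransversal) avoids t≢x (sym x-cls) ∈⊤ ∈⊤
                      (x∈p∪q⁺ (inj₁ t∈C)) (x∈p∪q⁺ (inj₂ x∈C′)) C∪C′⊆S+t+x)
      where
      open TransversalOmitting S-omits
      t≢x : t ≢ x
      t≢x refl = proj₂ (∈-minusGround⁻ x∈G′) t∈T
      C∪C′⊆S+t+x : ∀ z → z ∈ C ∪ C′ → z ∈ S ⊎ z ≡ t ⊎ z ≡ x
      C∪C′⊆S+t+x z z∈ with x∈p∪q⁻ C C′ z∈
      ... | inj₂ z∈C′ = map₂ inj₂ (∈-∪⁅⁆⁻ S (C′⊆S∪x z∈C′))
      ... | inj₁ z∈C with z ∈? T
      ... | yes z∈T = inj₂ (inj₁ (x∈⁅y⁆⇒x≡y t (subst (z ∈_) C∩T≡⁅t⁆ (x∈p∩q⁺ (z∈C , z∈T)))))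
      ... | no  z∉T = inj₁ (C∖T⊆S (∈-minusGround⁺ z∈C z∉T))

    noCircuitMeetsOnce⇒Ort : IsTight ⊤ cls circ → (∀ C → circ C → ∣ C ∩ T ∣ ≢ 1) →
                             Ort ⊤ cls circ T
    noCircuitMeetsOnce⇒Ort Z-tight noneMeetsOnce = T-transversal , Z−T-tight
      where
      Z−T-tight : IsTight (minusGround ⊤ T) cls (minusCirc circ T)
      Z−T-tight S (S⊆G′ , S-inj) count i (x₀ , _ , x₀-cls) avoids
        with Z-tight S ((λ _ → ∈⊤) , S-inj) (trans count (cong ∣_∣ (sym classLabels-minusGround)))
                     i (x₀ , ∈⊤ , x₀-cls) avoids
      ... | x , (_ , x-cls) , differ with Differ⇒NewCircuit {G = ⊤} {cls} differ
      ... | C , circ-C , C⊆S∪x , x∈C =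
        x , (∈-minusGround⁺ ∈⊤ x∉T , x-cls) ,
        NewCircuit⇒Differ {G = minusGround ⊤ T} {cls} (λ x∈S → avoids x x∈S x-cls)
          (C , (circ-C , C-off-T) , C⊆S∪x , x∈C)
        where
        S-off-T : ∀ y → y ∈ S → y ∉ T
        S-off-T y y∈S = proj₂ (∈-minusGround⁻ (S⊆G′ y∈S))
        x∉T : x ∉ T
        x∉T x∈T = noneMeetsOnce C circ-C
          (trans (cong ∣_∣ (p⊆q∪⁅x⁆⇒p∩r≡⁅x⁆ C⊆S∪x S-off-T x∈C x∈T)) (∣⁅x⁆∣≡1 x))
        C-off-T : ∀ y → y ∈ C → y ∉ T
        C-off-T y y∈C with ∈-∪⁅⁆⁻ S (C⊆S∪x y∈C)
        ... | inj₁ y∈S = S-off-T y y∈S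
        ... | inj₂ refl = x∉T

mainTheorem8 : ∀ {n m : ℕ} (cls : Fin n → Fin m) (circ : Fam n) →
    IsMultimatroid ⊤ cls circ →
    IsTight ⊤ cls circ →
    (∀ x → ∃ λ y → y ≢ x × cls y ≡ cls x) →
    ∀ T → Transversal ⊤ cls T →
    (Ort ⊤ cls circ T ⇔ (∀ C → circ C → ∣ C ∩ T ∣ ≢ 1))
mainTheorem8 cls circ multimatroid tight twoElements T T-transversal = mk⇔
  (Ort⇒noCircuitMeetsOnce T-transversal twoElements multimatroid)
  (noCircuitMeetsOnce⇒Ort T-transversal twoElements tight)
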